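{- Let $(E,sim,ser)$ be a comtrace alphabet. A step sequence $u\in\mathbb{S}^*$ is maximally concurrent if and only if it is canonical.
   Context: A comtrace alphabet is $(E,sim,ser)$ with $E$ finite, $sim\subseteq E\times E$ irreflexive and symmetric, $ser\subseteq sim$. Steps $\mathbb{S}$: nonempty $A\subseteq E$ with $(a,b)\in sim$ for all distinct $a,b\in A$. The comtrace congruence $\equiv$ on $\mathbb{S}^*$ is the reflexive symmetric transitive closure of the pairs $(wAz,wBCz)$ with $A,B,C\in\mathbb{S}$, $A=B\cup C$, $B\times C\subseteq ser$. For $x=A_1\dots A_k$, $\mathrm{length}(x)=k$; $A_i$ is maximally concurrent in $x$ iff for all $B\in\mathbb{S},y\in\mathbb{S}^*$, $By\equiv A_i\dots A_k\Rightarrow|B|\le|A_i|$; $mc(x)$ is the smallest $i$ such that $A_i$ is maximally concurrent in $x$. A step sequence $u=A_1\dots A_k$ is maximally concurrent iff (1) $v\equiv u\Rightarrow\mathrm{length}(u)\le\mathrm{length}(v)$ for all $v$, and (2) for all $i=1,\dots,k$ and all $w$, with $u_i=A_i\dots A_k$: $(u_i\equiv w\wedge\mathrm{length}(u_i)=\mathrm{length}(w))\Rightarrow mc(u_i)\le mc(w)$. The forward dependency $\mathbb{FD}$ consists of pairs of steps $(A,B)$ for which there is $C\in\mathbb{S}$ with $C\subseteq B$, $A\times C\subseteq ser$, $C\times(B\setminus C)\subseteq ser$; $A_1\dots A_k$ is canonical iff $(A_i,A_{i+1})\notin\mathbb{FD}$ for all $1\le i<k$. -}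

module Defs where

open import Level using (0ℓ)
open import Data.Nat using (ℕ; zero; suc; _≤_; _<_)
open import Data.Fin using (Fin)
open import Data.Fin.Subset using (Subset; _∈_; _∉_; _⊆_; _∪_; ∣_∣; Nonempty)
open import Data.List using (List; []; _∷_; _++_; length; drop)
open import Data.List.Relation.Unary.All using (All)
open import Data.Product using (_×_; ∃-syntax)
open import Data.Unit using (⊤)
open import Data.Empty using (⊥)
open import Relation.Nullary using (¬_)
open import Relation.Binary using (Rel; Irreflexive; Symmetric; Decidable)
open import Relation.Binary.PropositionalEquality using (_≡_)
open import Relation.Binary.Construct.Closure.Equivalence using (EqClosure)

record ComtraceAlphabet (n : ℕ) : Set₁ where
  field
    sim   : Rel (Fin n) 0ℓ
    ser   : Rel (Fin n) 0ℓ
    sim-irrefl : Irreflexive _≡_ sim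
    sim-sym    : Symmetric sim
    ser⊆sim    : ∀ {a b} → ser a b → sim a b
    sim?  : Decidable sim
    ser?  : Decidable ser

module Comtrace {n : ℕ} (Σ : ComtraceAlphabet n) where
  open ComtraceAlphabet Σ

  SerProd : Subset n → Subset n → Set
  SerProd A B = ∀ {a b} → a ∈ A → b ∈ B → ser a b

  IsStep : Subset n → Set
  IsStep A = Nonempty A × (∀ {a b} → a ∈ A → b ∈ A → ¬ a ≡ b → sim a b)

  StepSeq : List (Subset n) → Set
  StepSeq = All IsStep

  data _≈₁_ : Rel (List (Subset n)) 0ℓ where
    split : ∀ (w z : List (Subset n)) (A B C : Subset n) →
            IsStep A → IsStep B → IsStep C →
            A ≡ B ∪ C → SerProd B C →
            (w ++ A ∷ z) ≈₁ (w ++ B ∷ C ∷ z)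

  _≡c_ : Rel (List (Subset n)) 0ℓ
  _≡c_ = EqClosure _≈₁_

  MaxConcHead : List (Subset n) → Set
  MaxConcHead [] = ⊥
  MaxConcHead (A ∷ rest) =
    ∀ (B : Subset n) (y : List (Subset n)) → IsStep B → StepSeq y →
    (B ∷ y) ≡c (A ∷ rest) → ∣ B ∣ ≤ ∣ A ∣

  MaxConcAt : List (Subset n) → ℕ → Set
  MaxConcAt x i = MaxConcHead (drop i x)

  -- i is mc(x) (0-based): the smallest position of a maximally concurrent step
  IsMc : List (Subset n) → ℕ → Set
  IsMc x i = MaxConcAt x i × (∀ j → j < i → ¬ MaxConcAt x j)

  MaxConcurrent : List (Subset n) → Set
  MaxConcurrent u =
    (∀ v → StepSeq v → v ≡c u → length u ≤ length v) ×
    (∀ i → i < length u → ∀ w → StepSeq w →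
       drop i u ≡c w → length (drop i u) ≡ length w →
       ∀ a b → IsMc (drop i u) a → IsMc w b → a ≤ b)

  FD : Subset n → Subset n → Set
  FD A B = ∃[ C ] (IsStep C × C ⊆ B × SerProd A C ×
                   (∀ {c d} → c ∈ C → d ∈ B → d ∉ C → ser c d))

  Canonical : List (Subset n) → Set
  Canonical [] = ⊤
  Canonical (A ∷ []) = ⊤
  Canonical (A ∷ B ∷ rest) = ¬ FD A B × Canonical (B ∷ rest)

module Submission where

-- Write Occ x e k p when the k-th occurrence of the event e in x lies
-- in the step at position p.  Every generating rewrite A ↔ B C of the
-- comtrace congruence moves occurrences in a controlled way: each occurrence
-- survives, strict precedence of e before f is kept when (e,f) ∉ ser, and
-- weak precedence of e before f is kept when (f,e) ∉ ser (OrderInvariant).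
-- From this invariant, every occurrence of a canonical u is at least as
-- early as in any v ≡ u: otherwise the events of a step that v performs too
-- early witness a forward dependency (canonical-earliest).  Hence a canonical
-- sequence is shortest in its class and its first step contains the first
-- step of every equivalent sequence; applied to all suffixes this gives
-- "canonical ⇒ maximally concurrent".
--
-- Conversely, a forward dependency (A,B) at the head of A B z lets us either
-- merge A and B (a shorter equivalent sequence) or move part of B into A
-- (a larger first step).  The same rewrite strictly decreases a measure, so
-- every step sequence has a canonical representative.  Comparing mc of A B z
-- with mc of that representative (which is 0) contradicts maximal
-- concurrency.  Excluded middle is only used to prove ⊥, so those steps are
-- carried out under double negation.

open import Defs
open import Data.Bool using (Bool; true; false; if_then_else_)
open import Data.Empty using (⊥; ⊥-elim)
open import Data.Fin using (Fin)
import Data.Fin as Fin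
open import Data.Fin.Subset using (Subset; inside; outside; _∈_; _∉_; _⊆_; _∪_; _─_; ∣_∣; Nonempty)
open import Data.Fin.Subset.Properties
  using (_∈?_; nonempty?; x∈p∪q⁺; x∈p∪q⁻; p⊆q⇒∣p∣≤∣q∣; x∈p∧x∉q⇒x∈p─q; p─q⊆p; x∈p⇒∣p-x∣<∣p∣; ⊆-antisym)
open import Data.List using (List; []; _∷_; _++_; length; drop)
open import Data.List.Relation.Unary.All using ([]; _∷_)
open import Data.Nat using (ℕ; zero; suc; _+_; _≤_; _<_; z≤n; s≤s; s≤s⁻¹; _≤?_)
open import Data.Nat.Induction using (<-rec)
open import Data.Nat.Properties
  using (≤-refl; ≤-trans; ≤-antisym; ≤-<-trans; <-≤-trans; ≰⇒>; <⇒≱; 1+n≰n; n≤0⇒n≡0;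
         +-suc; +-assoc; m≤m+n; m<m+n; m<n+m; +-monoˡ-<; +-monoʳ-<)
open import Data.Product using (_×_; _,_; proj₁; proj₂; ∃; Σ-syntax)
open import Data.Sum using (_⊎_; inj₁; inj₂)
open import Data.Unit using (tt)
open import Data.Vec.Base using ([]; _∷_; here; there)
open import Function.Base using (_∘_)
open import Function.Bundles using (_⇔_; mk⇔)
open import Relation.Nullary using (¬_; Dec; yes; no; does)
open import Relation.Nullary.Decidable using (¬¬-excluded-middle)
open import Relation.Binary.PropositionalEquality using (_≡_; refl; sym; trans; cong; subst; subst₂; module ≡-Reasoning)
open import Relation.Binary.Construct.Closure.ReflexiveTransitive using (ε; _◅_)
open import Relation.Binary.Construct.Closure.Symmetric using (fwd; bwd)
import Relation.Binary.Construct.Closure.Equivalence as EqClosure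

Carves : ∀ {m} → (Fin m → Set) → Subset m → Set
Carves P C = (∀ {i} → i ∈ C → P i) × (∀ {i} → P i → i ∈ C)

¬¬-comprehension : ∀ {m} (P : Fin m → Set) → ¬ ¬ (Σ[ C ∈ Subset m ] Carves P C)
¬¬-comprehension {zero} P k = k ([] , (λ ()) , λ { {()} })
¬¬-comprehension {suc m} P k =
  ¬¬-excluded-middle λ d → ¬¬-comprehension (P ∘ Fin.suc) λ (C , carve) → k (extend d C carve)
  where
    extend : Dec (P Fin.zero) → (C : Subset m) → Carves (P ∘ Fin.suc) C →
             Σ[ C′ ∈ Subset (suc m) ] Carves P C′
    extend (yes p₀) C (C⊆P , P⊆C) =
      inside ∷ C , (λ { here → p₀ ; (there i∈C) → C⊆P i∈C })
                 , (λ { {Fin.zero} _ → here ; {Fin.suc i} pᵢ → there (P⊆C pᵢ) })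
    extend (no ¬p₀) C (C⊆P , P⊆C) =
      outside ∷ C , (λ { (there i∈C) → C⊆P i∈C })
                  , (λ { {Fin.zero} p₀ → ⊥-elim (¬p₀ p₀) ; {Fin.suc i} pᵢ → there (P⊆C pᵢ) })

Least : (ℕ → Set) → ℕ → Set
Least Q a = Q a × (∀ j → j < a → ¬ Q j)

¬¬-least : (Q : ℕ → Set) → ∀ j → Q j → ¬ ¬ (Σ[ a ∈ ℕ ] Least Q a)
¬¬-least Q = <-rec (λ j → Q j → ¬ ¬ (Σ[ a ∈ ℕ ] Least Q a)) search
  where
    search : ∀ j → (∀ {i} → i < j → Q i → ¬ ¬ (Σ[ a ∈ ℕ ] Least Q a)) →
             Q j → ¬ ¬ (Σ[ a ∈ ℕ ] Least Q a)
    search j below qj k = ¬¬-excluded-middle {A = Σ[ i ∈ ℕ ] (i < j × Q i)} λ where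
      (yes (i , i<j , qi)) → below i<j qi k
      (no none)            → k (j , qj , λ i i<j qi → none (i , i<j , qi))

∣p∪q∣≡∣p∣+∣q∣ : ∀ {m} (p q : Subset m) → (∀ {x} → x ∈ p → x ∈ q → ⊥) →
                ∣ p ∪ q ∣ ≡ ∣ p ∣ + ∣ q ∣
∣p∪q∣≡∣p∣+∣q∣ []            []            _        = refl
∣p∪q∣≡∣p∣+∣q∣ (inside  ∷ p) (inside  ∷ q) disjoint = ⊥-elim (disjoint here here)
∣p∪q∣≡∣p∣+∣q∣ (inside  ∷ p) (outside ∷ q) disjoint =
  cong suc (∣p∪q∣≡∣p∣+∣q∣ p q (λ x∈p x∈q → disjoint (there x∈p) (there x∈q)))
∣p∪q∣≡∣p∣+∣q∣ (outside ∷ p) (inside  ∷ q) disjoint =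
  trans (cong suc (∣p∪q∣≡∣p∣+∣q∣ p q (λ x∈p x∈q → disjoint (there x∈p) (there x∈q))))
        (sym (+-suc ∣ p ∣ ∣ q ∣))
∣p∪q∣≡∣p∣+∣q∣ (outside ∷ p) (outside ∷ q) disjoint =
  ∣p∪q∣≡∣p∣+∣q∣ p q (λ x∈p x∈q → disjoint (there x∈p) (there x∈q))

x∈p⇒0<∣p∣ : ∀ {m} {p : Subset m} {x} → x ∈ p → 0 < ∣ p ∣
x∈p⇒0<∣p∣ x∈p = ≤-<-trans z≤n (x∈p⇒∣p-x∣<∣p∣ x∈p)

x∈p─q⇒x∉q : ∀ {m} (p q : Subset m) {x} → x ∈ p ─ q → x ∉ q
x∈p─q⇒x∉q (_ ∷ p) (inside  ∷ q) ()        here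
x∈p─q⇒x∉q (_ ∷ p) (outside ∷ q) here      ()
x∈p─q⇒x∉q (_ ∷ p) (_       ∷ q) (there x∈) (there x∈q) = x∈p─q⇒x∉q p q x∈ x∈q

p≡q∪[p─q] : ∀ {m} {p q : Subset m} → q ⊆ p → p ≡ q ∪ (p ─ q)
p≡q∪[p─q] {p = p} {q} q⊆p = ⊆-antisym into back
  where
    into : p ⊆ q ∪ (p ─ q)
    into {x} x∈p with x ∈? q
    ... | yes x∈q = x∈p∪q⁺ (inj₁ x∈q)
    ... | no  x∉q = x∈p∪q⁺ (inj₂ (x∈p∧x∉q⇒x∈p─q x∈p x∉q))
    back : q ∪ (p ─ q) ⊆ p
    back {x} x∈∪ with x∈p∪q⁻ q (p ─ q) x∈∪
    ... | inj₁ x∈q  = q⊆p x∈q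
    ... | inj₂ x∈p─q = p─q⊆p p q x∈p─q

module ComtraceTheory {n : ℕ} (Σ : ComtraceAlphabet n) where
  open ComtraceAlphabet Σ
  open Comtrace Σ

  private
    S : Set
    S = Subset n
    L : Set
    L = List S

  ser-disjoint : ∀ {B C : S} {e} → SerProd B C → e ∈ B → e ∈ C → ⊥
  ser-disjoint B×C⊆ser e∈B e∈C = sim-irrefl refl (ser⊆sim (B×C⊆ser e∈B e∈C))

  ∪-step : ∀ {X Y} → IsStep X → IsStep Y → SerProd X Y → IsStep (X ∪ Y)
  ∪-step {X} {Y} ((x , x∈X) , simX) (_ , simY) X×Y⊆ser = (x , x∈p∪q⁺ (inj₁ x∈X)) , simX∪Y
    where
      simX∪Y : ∀ {a b} → a ∈ X ∪ Y → b ∈ X ∪ Y → ¬ a ≡ b → sim a b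
      simX∪Y {a} {b} a∈ b∈ a≢b with x∈p∪q⁻ X Y a∈ | x∈p∪q⁻ X Y b∈
      ... | inj₁ a∈X | inj₁ b∈X = simX a∈X b∈X a≢b
      ... | inj₂ a∈Y | inj₂ b∈Y = simY a∈Y b∈Y a≢b
      ... | inj₁ a∈X | inj₂ b∈Y = ser⊆sim (X×Y⊆ser a∈X b∈Y)
      ... | inj₂ a∈Y | inj₁ b∈X = sim-sym (ser⊆sim (X×Y⊆ser b∈X a∈Y))

  ⊆-step : ∀ {B C} → IsStep B → Nonempty C → C ⊆ B → IsStep C
  ⊆-step (_ , simB) ne C⊆B = ne , λ a∈C b∈C a≢b → simB (C⊆B a∈C) (C⊆B b∈C) a≢b

  ≡c-sym : ∀ {x y} → x ≡c y → y ≡c x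
  ≡c-sym = EqClosure.symmetric _≈₁_

  ≡c-trans : ∀ {x y z} → x ≡c y → y ≡c z → x ≡c z
  ≡c-trans = EqClosure.transitive _≈₁_

  ≡c-cons : ∀ X {x y} → x ≡c y → (X ∷ x) ≡c (X ∷ y)
  ≡c-cons X = EqClosure.gmap (X ∷_) λ { (split w z A B C sA sB sC A≡ B×C⊆ser) →
                                          split (X ∷ w) z A B C sA sB sC A≡ B×C⊆ser }

  data At : L → ℕ → S → Set where
    at-here  : ∀ {A x} → At (A ∷ x) zero A
    at-there : ∀ {A B x p} → At x p A → At (B ∷ x) (suc p) A

  -- Occ x e k p: the k-th occurrence (from 0) of e in x lies in the step at
  -- position p.
  data Occ : L → Fin n → ℕ → ℕ → Set where
    in-head   : ∀ {A x e} → e ∈ A → Occ (A ∷ x) e zero zero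
    skip-head : ∀ {A x e k p} → e ∉ A → Occ x e k p → Occ (A ∷ x) e k (suc p)
    past-head : ∀ {A x e k p} → e ∈ A → Occ x e k p → Occ (A ∷ x) e (suc k) (suc p)

  occ-functional : ∀ {x e k p q} → Occ x e k p → Occ x e k q → p ≡ q
  occ-functional (in-head _)       (in-head _)      = refl
  occ-functional (in-head e∈)      (skip-head e∉ _) = ⊥-elim (e∉ e∈)
  occ-functional (skip-head e∉ _)  (in-head e∈)     = ⊥-elim (e∉ e∈)
  occ-functional (skip-head _ o)  (skip-head _ o′) = cong suc (occ-functional o o′)
  occ-functional (skip-head e∉ _) (past-head e∈ _) = ⊥-elim (e∉ e∈)
  occ-functional (past-head e∈ _) (skip-head e∉ _) = ⊥-elim (e∉ e∈)
  occ-functional (past-head _ o)  (past-head _ o′) = cong suc (occ-functional o o′)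

  occ-in-step : ∀ {x e k p A} → Occ x e k p → At x p A → e ∈ A
  occ-in-step (in-head e∈)    at-here      = e∈
  occ-in-step (skip-head _ o) (at-there a) = occ-in-step o a
  occ-in-step (past-head _ o) (at-there a) = occ-in-step o a

  occ-step : ∀ {x e k p} → Occ x e k p → ∃ λ A → At x p A
  occ-step (in-head _)     = _ , at-here
  occ-step (skip-head _ o) = let (A , a) = occ-step o in A , at-there a
  occ-step (past-head _ o) = let (A , a) = occ-step o in A , at-there a

  step-occ : ∀ {x e p A} → At x p A → e ∈ A → ∃ λ k → Occ x e k p
  step-occ at-here e∈ = zero , in-head e∈
  step-occ {e = e} (at-there {B = B} a) e∈ with step-occ a e∈ | e ∈? B
  ... | k , o | yes e∈B = suc k , past-head e∈B o
  ... | k , o | no  e∉B = k , skip-head e∉B o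

  occ-<length : ∀ {x e k p} → Occ x e k p → p < length x
  occ-<length (in-head _)     = s≤s z≤n
  occ-<length (skip-head _ o) = s≤s (occ-<length o)
  occ-<length (past-head _ o) = s≤s (occ-<length o)

  at-previous : ∀ {x p B} → At x (suc p) B → ∃ λ A → At x p A
  at-previous (at-there at-here)      = _ , at-here
  at-previous (at-there (at-there a)) = let (A , a′) = at-previous (at-there a) in A , at-there a′

  at-last : ∀ A (r : L) → ∃ λ X → At (A ∷ r) (length r) X
  at-last A []      = A , at-here
  at-last A (B ∷ r) = let (X , a) = at-last B r in X , at-there a

  at-split : ∀ (w : L) {X z} → At (w ++ X ∷ z) (length w) X
  at-split []      = at-here
  at-split (_ ∷ w) = at-there (at-split w)

  at-split-next : ∀ (w : L) {B C z} → At (w ++ B ∷ C ∷ z) (suc (length w)) C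
  at-split-next []      = at-there at-here
  at-split-next (_ ∷ w) = at-there (at-split-next w)

  step-at : ∀ {x p A} → StepSeq x → At x p A → IsStep A
  step-at (sA ∷ _)  at-here      = sA
  step-at (_  ∷ sx) (at-there a) = step-at sx a

  -- Relocation of positions when the step at position m is split into
  -- B C (splitPos m b p; b tells whether the event lies in B) or when the
  -- steps at positions m and m+1 are merged (mergePos m q).
  splitPos : ℕ → Bool → ℕ → ℕ
  splitPos zero    b zero    = if b then zero else suc zero
  splitPos zero    _ (suc p) = suc (suc p)
  splitPos (suc m) _ zero    = zero
  splitPos (suc m) b (suc p) = suc (splitPos m b p)

  mergePos : ℕ → ℕ → ℕ
  mergePos zero    zero          = zero
  mergePos zero    (suc zero)    = zero
  mergePos zero    (suc (suc q)) = suc q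
  mergePos (suc m) zero          = zero
  mergePos (suc m) (suc q)       = suc (mergePos m q)

  splitPos-< : ∀ m b b′ {p p′} → p < p′ → splitPos m b p < splitPos m b′ p′
  splitPos-< zero    true  _  {zero}  {suc _} _         = s≤s z≤n
  splitPos-< zero    false _  {zero}  {suc _} _         = s≤s (s≤s z≤n)
  splitPos-< zero    _     _  {suc _} {suc _} (s≤s p<p′) = s≤s (s≤s p<p′)
  splitPos-< (suc m) _     _  {zero}  {suc _} _         = s≤s z≤n
  splitPos-< (suc m) b     b′ {suc _} {suc _} (s≤s p<p′) = s≤s (splitPos-< m b b′ p<p′)

  -- Weak order survives unless both events sit in the split step and only
  -- the later one goes to the first half.
  splitPos-≤ : ∀ m b b′ {p p′} → p ≤ p′ → (p ≡ m → p′ ≡ m → b′ ≡ true → b ≡ true) →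
               splitPos m b p ≤ splitPos m b′ p′
  splitPos-≤ zero    true  _     {zero}  {zero}  _ _ = z≤n
  splitPos-≤ zero    false true  {zero}  {zero}  _ ok with ok refl refl refl
  ... | ()
  splitPos-≤ zero    false false {zero}  {zero}  _ _ = ≤-refl
  splitPos-≤ zero    true  _     {zero}  {suc _} _ _ = z≤n
  splitPos-≤ zero    false _     {zero}  {suc _} _ _ = s≤s z≤n
  splitPos-≤ zero    _     _     {suc _} {suc _} (s≤s p≤p′) _ = s≤s (s≤s p≤p′)
  splitPos-≤ (suc m) _     _     {zero}          _ _ = z≤n
  splitPos-≤ (suc m) b     b′    {suc _} {suc _} (s≤s p≤p′) ok =
    s≤s (splitPos-≤ m b b′ p≤p′ λ p≡m p′≡m → ok (cong suc p≡m) (cong suc p′≡m))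

  mergePos-≤ : ∀ m {q q′} → q ≤ q′ → mergePos m q ≤ mergePos m q′
  mergePos-≤ zero    {zero}                        _ = z≤n
  mergePos-≤ zero    {suc zero}    {suc zero}      _ = z≤n
  mergePos-≤ zero    {suc zero}    {suc (suc _)}   _ = z≤n
  mergePos-≤ zero    {suc (suc _)} {suc (suc _)} (s≤s (s≤s q≤q′)) = s≤s q≤q′
  mergePos-≤ (suc m) {zero}                        _ = z≤n
  mergePos-≤ (suc m) {suc _}       {suc _}   (s≤s q≤q′) = s≤s (mergePos-≤ m q≤q′)

  mergePos-< : ∀ m {q q′} → q < q′ → (q ≡ m → q′ ≡ suc m → ⊥) → mergePos m q < mergePos m q′
  mergePos-< zero    {zero}        {suc zero}    _ apart = ⊥-elim (apart refl refl)
  mergePos-< zero    {zero}        {suc (suc _)} _ _ = s≤s z≤n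
  mergePos-< zero    {suc zero}    {suc zero}    (s≤s ()) _
  mergePos-< zero    {suc zero}    {suc (suc _)} _ _ = s≤s z≤n
  mergePos-< zero    {suc (suc _)} {suc (suc _)} (s≤s (s≤s q<q′)) _ = s≤s q<q′
  mergePos-< (suc m) {zero}        {suc _}       _ _ = s≤s z≤n
  mergePos-< (suc m) {suc _}       {suc _}       (s≤s q<q′) apart =
    s≤s (mergePos-< m q<q′ λ q≡m q′≡m → apart (cong suc q≡m) (cong suc q′≡m))

  occ-split-head : ∀ {B C z e k p} → SerProd B C → (d : Dec (e ∈ B)) →
                   Occ ((B ∪ C) ∷ z) e k p → Occ (B ∷ C ∷ z) e k (splitPos zero (does d) p)
  occ-split-head         _ (yes e∈B) (in-head _) = in-head e∈B
  occ-split-head {B} {C} _ (no e∉B)  (in-head e∈) with x∈p∪q⁻ B C e∈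
  ... | inj₁ e∈B = ⊥-elim (e∉B e∈B)
  ... | inj₂ e∈C = skip-head e∉B (in-head e∈C)
  occ-split-head _ (yes e∈B) (skip-head e∉ _) = ⊥-elim (e∉ (x∈p∪q⁺ (inj₁ e∈B)))
  occ-split-head _ (no e∉B)  (skip-head e∉ o) =
    skip-head e∉B (skip-head (λ e∈C → e∉ (x∈p∪q⁺ (inj₂ e∈C))) o)
  occ-split-head B×C⊆ser (yes e∈B) (past-head _ o) = past-head e∈B (skip-head (ser-disjoint B×C⊆ser e∈B) o)
  occ-split-head {B} {C} _ (no e∉B) (past-head e∈ o) with x∈p∪q⁻ B C e∈
  ... | inj₁ e∈B = ⊥-elim (e∉B e∈B)
  ... | inj₂ e∈C = skip-head e∉B (past-head e∈C o)

  occ-split : ∀ (w : L) {B C z e k p} → SerProd B C → (d : Dec (e ∈ B)) →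
              Occ (w ++ (B ∪ C) ∷ z) e k p → Occ (w ++ B ∷ C ∷ z) e k (splitPos (length w) (does d) p)
  occ-split []      B×C⊆ser d o               = occ-split-head B×C⊆ser d o
  occ-split (_ ∷ w) _       _ (in-head e∈)    = in-head e∈
  occ-split (_ ∷ w) B×C⊆ser d (skip-head e∉ o) = skip-head e∉ (occ-split w B×C⊆ser d o)
  occ-split (_ ∷ w) B×C⊆ser d (past-head e∈ o) = past-head e∈ (occ-split w B×C⊆ser d o)

  occ-merge-head : ∀ {B C z e k q} → SerProd B C →
                   Occ (B ∷ C ∷ z) e k q → Occ ((B ∪ C) ∷ z) e k (mergePos zero q)
  occ-merge-head _ (in-head e∈B)                  = in-head (x∈p∪q⁺ (inj₁ e∈B))
  occ-merge-head _ (skip-head _ (in-head e∈C))    = in-head (x∈p∪q⁺ (inj₂ e∈C))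
  occ-merge-head {B} {C} {e = e} _ (skip-head e∉B (skip-head e∉C o)) = skip-head e∉B∪C o
    where
      e∉B∪C : e ∉ B ∪ C
      e∉B∪C e∈ with x∈p∪q⁻ B C e∈
      ... | inj₁ e∈B = e∉B e∈B
      ... | inj₂ e∈C = e∉C e∈C
  occ-merge-head _ (skip-head _ (past-head e∈C o)) = past-head (x∈p∪q⁺ (inj₂ e∈C)) o
  occ-merge-head B×C⊆ser (past-head e∈B (in-head e∈C))   = ⊥-elim (ser-disjoint B×C⊆ser e∈B e∈C)
  occ-merge-head _       (past-head e∈B (skip-head _ o)) = past-head (x∈p∪q⁺ (inj₁ e∈B)) o
  occ-merge-head B×C⊆ser (past-head e∈B (past-head e∈C _)) = ⊥-elim (ser-disjoint B×C⊆ser e∈B e∈C)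

  occ-merge : ∀ (w : L) {B C z e k q} → SerProd B C →
              Occ (w ++ B ∷ C ∷ z) e k q → Occ (w ++ (B ∪ C) ∷ z) e k (mergePos (length w) q)
  occ-merge []      B×C⊆ser o               = occ-merge-head B×C⊆ser o
  occ-merge (_ ∷ w) _       (in-head e∈)    = in-head e∈
  occ-merge (_ ∷ w) B×C⊆ser (skip-head e∉ o) = skip-head e∉ (occ-merge w B×C⊆ser o)
  occ-merge (_ ∷ w) B×C⊆ser (past-head e∈ o) = past-head e∈ (occ-merge w B×C⊆ser o)

  record OrderInvariant (x y : L) : Set where
    field
      transfer : ∀ {e k p} → Occ x e k p → ∃ λ q → Occ y e k q
      keeps-<  : ∀ {e f k l p q p′ q′} → ¬ ser e f →
                 Occ x e k p → Occ x f l q → p < q → Occ y e k p′ → Occ y f l q′ → p′ < q′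
      keeps-≤  : ∀ {e f k l p q p′ q′} → ¬ ser f e →
                 Occ x e k p → Occ x f l q → p ≤ q → Occ y e k p′ → Occ y f l q′ → p′ ≤ q′
  open OrderInvariant

  invariant-refl : ∀ {x} → OrderInvariant x x
  invariant-refl = record
    { transfer = λ o → _ , o
    ; keeps-<  = λ _ oe of p<q oe′ of′ → subst₂ _<_ (occ-functional oe oe′) (occ-functional of of′) p<q
    ; keeps-≤  = λ _ oe of p≤q oe′ of′ → subst₂ _≤_ (occ-functional oe oe′) (occ-functional of of′) p≤q
    }

  invariant-trans : ∀ {x y z} → OrderInvariant x y → OrderInvariant y z → OrderInvariant x z
  invariant-trans I J = record
    { transfer = λ o → transfer J (proj₂ (transfer I o))
    ; keeps-<  = λ ¬ser oe of p<q → keeps-< J ¬ser (via oe) (via of) (keeps-< I ¬ser oe of p<q (via oe) (via of))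
    ; keeps-≤  = λ ¬ser oe of p≤q → keeps-≤ J ¬ser (via oe) (via of) (keeps-≤ I ¬ser oe of p≤q (via oe) (via of))
    }
    where
      via : ∀ {e k p} (o : Occ _ e k p) → Occ _ e k (proj₁ (transfer I o))
      via o = proj₂ (transfer I o)

  invariant-split : ∀ (w z : L) B C → SerProd B C →
                    OrderInvariant (w ++ (B ∪ C) ∷ z) (w ++ B ∷ C ∷ z)
  invariant-split w z B C B×C⊆ser = record
    { transfer = λ {e} o → _ , moved e o
    ; keeps-<  = λ {e} {f} _ oe of p<q oe′ of′ →
        subst₂ _<_ (occ-functional (moved e oe) oe′) (occ-functional (moved f of) of′)
               (splitPos-< (length w) _ _ p<q)
    ; keeps-≤  = λ {e} {f} ¬ser oe of p≤q oe′ of′ →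
        subst₂ _≤_ (occ-functional (moved e oe) oe′) (occ-functional (moved f of) of′)
               (splitPos-≤ (length w) _ _ p≤q (first-half ¬ser oe))
    }
    where
      moved : ∀ e {k p} → Occ (w ++ (B ∪ C) ∷ z) e k p →
              Occ (w ++ B ∷ C ∷ z) e k (splitPos (length w) (does (e ∈? B)) p)
      moved e = occ-split w B×C⊆ser (e ∈? B)
      -- If f (weakly after e) goes to B while e goes to C, then (f,e) ∈ ser.
      first-half : ∀ {e f k p q} → ¬ ser f e → Occ (w ++ (B ∪ C) ∷ z) e k p →
                   p ≡ length w → q ≡ length w → does (f ∈? B) ≡ true → does (e ∈? B) ≡ true
      first-half {e} {f} ¬ser oe refl refl f∈B with e ∈? B | f ∈? B
      ... | yes _   | _       = refl
      ... | no _    | no _    = f∈B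
      ... | no e∉B  | yes f∈B with x∈p∪q⁻ B C (occ-in-step oe (at-split w))
      ...   | inj₁ e∈B = ⊥-elim (e∉B e∈B)
      ...   | inj₂ e∈C = ⊥-elim (¬ser (B×C⊆ser f∈B e∈C))

  invariant-merge : ∀ (w z : L) B C → SerProd B C →
                    OrderInvariant (w ++ B ∷ C ∷ z) (w ++ (B ∪ C) ∷ z)
  invariant-merge w z B C B×C⊆ser = record
    { transfer = λ o → _ , moved o
    ; keeps-<  = λ ¬ser oe of p<q oe′ of′ →
        subst₂ _<_ (occ-functional (moved oe) oe′) (occ-functional (moved of) of′)
               (mergePos-< (length w) p<q λ { refl refl →
                  ¬ser (B×C⊆ser (occ-in-step oe (at-split w)) (occ-in-step of (at-split-next w))) })
    ; keeps-≤  = λ _ oe of p≤q oe′ of′ →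
        subst₂ _≤_ (occ-functional (moved oe) oe′) (occ-functional (moved of) of′)
               (mergePos-≤ (length w) p≤q)
    }
    where
      moved : ∀ {e k q} → Occ (w ++ B ∷ C ∷ z) e k q → Occ (w ++ (B ∪ C) ∷ z) e k (mergePos (length w) q)
      moved = occ-merge w B×C⊆ser

  ≡c⇒invariant : ∀ {x y} → x ≡c y → OrderInvariant x y
  ≡c⇒invariant ε = invariant-refl
  ≡c⇒invariant (fwd (split w z _ B C _ _ _ refl B×C⊆ser) ◅ rest) =
    invariant-trans (invariant-split w z B C B×C⊆ser) (≡c⇒invariant rest)
  ≡c⇒invariant (bwd (split w z _ B C _ _ _ refl B×C⊆ser) ◅ rest) =
    invariant-trans (invariant-merge w z B C B×C⊆ser) (≡c⇒invariant rest)

  canonical-adjacent : ∀ {u p A B} → Canonical u → At u p A → At u (suc p) B → ¬ FD A B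
  canonical-adjacent {_ ∷ _ ∷ _} (¬fd , _) at-here (at-there at-here) = ¬fd
  canonical-adjacent {_ ∷ _ ∷ _} (_ , cu) (at-there a) (at-there b) = canonical-adjacent cu a b
  canonical-adjacent {_ ∷ []} _ _ (at-there ())

  canonical-tail : ∀ {A r} → Canonical (A ∷ r) → Canonical r
  canonical-tail {r = []}    _        = tt
  canonical-tail {r = _ ∷ _} (_ , cr) = cr

  Early : L → L → ℕ → Fin n → Set
  Early u v p c = Σ[ k ∈ ℕ ] Σ[ q ∈ ℕ ] (Occ u c k (suc p) × Occ v c k q × q ≤ p)

  early-events-FD : ∀ {u v p A B} (C : S) → OrderInvariant u v → IsStep B →
    At u p A → At u (suc p) B → (∀ {e k q} → Occ u e k p → Occ v e k q → p ≤ q) →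
    Carves (Early u v p) C → Nonempty C → FD A B
  early-events-FD {u} {v} {p} {A} {B} C I sB atA atB A-not-early (C⊆E , E⊆C) neC =
    C , ⊆-step sB neC C⊆B , C⊆B , A×C⊆ser , C×[B─C]⊆ser
    where
      C⊆B : C ⊆ B
      C⊆B c∈C = let (_ , _ , ou , _) = C⊆E c∈C in occ-in-step ou atB
      A-late : ∀ {a} → a ∈ A → Σ[ k ∈ ℕ ] Σ[ q ∈ ℕ ] (Occ u a k p × Occ v a k q × p ≤ q)
      A-late a∈A = let (k , oua) = step-occ atA a∈A ; (q , ova) = transfer I oua
                   in k , q , oua , ova , A-not-early oua ova
      B-in-v : ∀ {d} → d ∈ B → Σ[ k ∈ ℕ ] Σ[ q ∈ ℕ ] (Occ u d k (suc p) × Occ v d k q)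
      B-in-v d∈B = let (k , oud) = step-occ atB d∈B ; (q , ovd) = transfer I oud
                   in k , q , oud , ovd
      -- (a,c) ∉ ser would put a strictly before c in v, i.e. earlier than p.
      A×C⊆ser : SerProd A C
      A×C⊆ser {a} {c} a∈A c∈C with ser? a c | C⊆E c∈C | A-late a∈A
      ... | yes s | _ | _ = s
      ... | no ¬s | (_ , _ , ouc , ovc , qc≤p) | (_ , _ , oua , ova , p≤qa) =
        ⊥-elim (<⇒≱ (keeps-< I ¬s oua ouc ≤-refl ova ovc) (≤-trans qc≤p p≤qa))
      -- (c,d) ∉ ser would put d weakly before c in v, making d early too.
      C×[B─C]⊆ser : ∀ {c d} → c ∈ C → d ∈ B → d ∉ C → ser c d
      C×[B─C]⊆ser {c} {d} c∈C d∈B d∉C with ser? c d | C⊆E c∈C | B-in-v d∈B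
      ... | yes s | _ | _ = s
      ... | no ¬s | (_ , _ , ouc , ovc , qc≤p) | (_ , _ , oud , ovd) =
        ⊥-elim (d∉C (E⊆C (_ , _ , oud , ovd , ≤-trans (keeps-≤ I ¬s oud ouc ≤-refl ovd ovc) qc≤p)))

  canonical-earliest : ∀ {u v} → Canonical u → StepSeq u → OrderInvariant u v →
                       ∀ p {e k q} → Occ u e k p → Occ v e k q → p ≤ q
  canonical-earliest cu su I zero _ _ = z≤n
  canonical-earliest {u} {v} cu su I (suc p) {e} {k} {q} ou ov with suc p ≤? q
  ... | yes p<q = p<q
  ... | no  p≮q =
    let (B , atB) = occ-step ou ; (A , atA) = at-previous atB in
    ⊥-elim (¬¬-comprehension (Early u v p) λ (C , carve) →
      canonical-adjacent cu atA atB
        (early-events-FD C I (step-at su atB) atA atB (canonical-earliest cu su I p) carve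
           (e , proj₂ carve (k , q , ou , ov , s≤s⁻¹ (≰⇒> p≮q)))))

  -- A canonical sequence is a shortest one in its class: its last event
  -- occurs in any equivalent v no earlier than in u.
  canonical-shortest : ∀ {u v} → Canonical u → StepSeq u → v ≡c u → length u ≤ length v
  canonical-shortest {[]}    _  _  _   = z≤n
  canonical-shortest {A ∷ r} {v} cu su v≡u =
    let (X , atX) = at-last A r ; ((e , e∈X) , _) = step-at su atX
        (_ , ou) = step-occ atX e∈X ; (_ , ov) = transfer I ou
    in ≤-trans (s≤s (canonical-earliest cu su I (length r) ou ov)) (occ-<length ov)
    where
      I : OrderInvariant (A ∷ r) v
      I = ≡c⇒invariant (≡c-sym v≡u)

  -- The first step of a canonical sequence contains the first step of every
  -- equivalent sequence, so it is maximally concurrent.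
  canonical-head-maximal : ∀ {A r} → Canonical (A ∷ r) → StepSeq (A ∷ r) → MaxConcHead (A ∷ r)
  canonical-head-maximal {A} {r} cu su B y _ _ By≡Ar = p⊆q⇒∣p∣≤∣q∣ B⊆A
    where
      B⊆A : B ⊆ A
      B⊆A {e} e∈B =
        let (p , ou) = transfer (≡c⇒invariant By≡Ar) (in-head {x = y} e∈B)
            p≤0 = canonical-earliest cu su (≡c⇒invariant (≡c-sym By≡Ar)) p ou (in-head e∈B)
        in occ-in-step (subst (Occ (A ∷ r) e zero) (n≤0⇒n≡0 p≤0) ou) at-here

  canonical-suffix-heads : ∀ {u} → Canonical u → StepSeq u → ∀ i → i < length u → MaxConcAt u i
  canonical-suffix-heads {_ ∷ _} cu su       zero    _          = canonical-head-maximal cu su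
  canonical-suffix-heads {_ ∷ _} cu (_ ∷ su) (suc i) (s≤s i<len) =
    canonical-suffix-heads (canonical-tail cu) su i i<len

  canonical⇒maxconc : ∀ {u} → Canonical u → StepSeq u → MaxConcurrent u
  canonical⇒maxconc {u} cu su = (λ _ _ v≡u → canonical-shortest cu su v≡u) , mc-first
    where
      mc-first : ∀ i → i < length u → ∀ w → StepSeq w → drop i u ≡c w → length (drop i u) ≡ length w →
                 ∀ a b → IsMc (drop i u) a → IsMc w b → a ≤ b
      mc-first _ _       _ _ _ _ zero    _ _            _ = z≤n
      mc-first i i<len _ _ _ _ (suc _) _ (_ , minimal) _ =
        ⊥-elim (minimal zero (s≤s z≤n) (canonical-suffix-heads cu su i i<len))

  data FDRewrite (A B : S) (z : L) : Set where
    merge   : IsStep (A ∪ B) → ((A ∪ B) ∷ z) ≡c (A ∷ B ∷ z) → ∣ A ∪ B ∣ ≡ ∣ A ∣ + ∣ B ∣ →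
              FDRewrite A B z
    advance : ∀ C D → IsStep (A ∪ C) → IsStep D → ((A ∪ C) ∷ D ∷ z) ≡c (A ∷ B ∷ z) →
              ∣ A ∪ C ∣ + ∣ D ∣ ≡ ∣ A ∣ + ∣ B ∣ → ∣ A ∣ < ∣ A ∪ C ∣ → ∣ D ∣ < ∣ B ∣ →
              FDRewrite A B z

  -- Splitting B into C and D = B ─ C: if D is empty, A × B ⊆ ser and A B
  -- merges; otherwise A B ≡ A C D ≡ (A ∪ C) D.
  fd-rewrite : ∀ {A B} z → IsStep A → IsStep B → FD A B → FDRewrite A B z
  fd-rewrite {A} {B} z sA sB (C , sC , C⊆B , A×C⊆ser , C×[B─C]⊆ser) with nonempty? (B ─ C)
  ... | no empty =
    merge sA∪B (fwd (split [] z (A ∪ B) A B sA∪B sA sB refl A×B⊆ser) ◅ ε)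
          (∣p∪q∣≡∣p∣+∣q∣ A B (ser-disjoint A×B⊆ser))
    where
      A×B⊆ser : SerProd A B
      A×B⊆ser {a} {b} a∈A b∈B with b ∈? C
      ... | yes b∈C = A×C⊆ser a∈A b∈C
      ... | no  b∉C = ⊥-elim (empty (b , x∈p∧x∉q⇒x∈p─q b∈B b∉C))
      sA∪B : IsStep (A ∪ B)
      sA∪B = ∪-step sA sB A×B⊆ser
  ... | yes neD = advance C D sA∪C sD equivalent sizes A<A∪C D<B
    where
      D : S
      D = B ─ C
      B≡C∪D : B ≡ C ∪ D
      B≡C∪D = p≡q∪[p─q] C⊆B
      sD : IsStep D
      sD = ⊆-step sB neD (p─q⊆p B C)
      sA∪C : IsStep (A ∪ C)
      sA∪C = ∪-step sA sC A×C⊆ser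
      C×D⊆ser : SerProd C D
      C×D⊆ser c∈C d∈D = C×[B─C]⊆ser c∈C (p─q⊆p B C d∈D) (x∈p─q⇒x∉q B C d∈D)
      ∣A∪C∣ : ∣ A ∪ C ∣ ≡ ∣ A ∣ + ∣ C ∣
      ∣A∪C∣ = ∣p∪q∣≡∣p∣+∣q∣ A C (ser-disjoint A×C⊆ser)
      ∣B∣ : ∣ B ∣ ≡ ∣ C ∣ + ∣ D ∣
      ∣B∣ = trans (cong ∣_∣ B≡C∪D) (∣p∪q∣≡∣p∣+∣q∣ C D (ser-disjoint C×D⊆ser))
      0<∣C∣ : 0 < ∣ C ∣
      0<∣C∣ = x∈p⇒0<∣p∣ (proj₂ (proj₁ sC))
      equivalent : ((A ∪ C) ∷ D ∷ z) ≡c (A ∷ B ∷ z)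
      equivalent = fwd (split [] (D ∷ z) (A ∪ C) A C sA∪C sA sC refl A×C⊆ser)
                 ◅ bwd (split (A ∷ []) z B C D sB sC sD B≡C∪D C×D⊆ser) ◅ ε
      sizes : ∣ A ∪ C ∣ + ∣ D ∣ ≡ ∣ A ∣ + ∣ B ∣
      sizes = begin
        ∣ A ∪ C ∣ + ∣ D ∣         ≡⟨ cong (_+ ∣ D ∣) ∣A∪C∣ ⟩
        (∣ A ∣ + ∣ C ∣) + ∣ D ∣   ≡⟨ +-assoc (∣ A ∣) (∣ C ∣) (∣ D ∣) ⟩
        ∣ A ∣ + (∣ C ∣ + ∣ D ∣)   ≡⟨ cong (∣ A ∣ +_) (sym ∣B∣) ⟩
        ∣ A ∣ + ∣ B ∣             ∎
        where open ≡-Reasoning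
      A<A∪C : ∣ A ∣ < ∣ A ∪ C ∣
      A<A∪C = subst (∣ A ∣ <_) (sym ∣A∪C∣) (m<m+n ∣ A ∣ 0<∣C∣)
      D<B : ∣ D ∣ < ∣ B ∣
      D<B = subst (∣ D ∣ <_) (sym ∣B∣) (m<n+m ∣ D ∣ 0<∣C∣)

  -- Termination measure for rewriting towards a canonical sequence: the
  -- size (number of event occurrences) is invariant, and the lateness (the
  -- sum over all positions of the number of occurrences after that position)
  -- strictly decreases under each rewrite of FDRewrite.
  size : L → ℕ
  size []      = 0
  size (A ∷ x) = ∣ A ∣ + size x

  lateness : L → ℕ
  lateness []      = 0
  lateness (A ∷ x) = size x + lateness x

  Improvement : L → Set
  Improvement x = Σ[ x′ ∈ L ] (x′ ≡c x × StepSeq x′ × lateness x′ < lateness x × size x′ ≡ size x)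

  rewrite-improves : ∀ {A B r} → IsStep A → IsStep B → StepSeq r → FDRewrite A B r →
                     Improvement (A ∷ B ∷ r)
  rewrite-improves {A} {B} {r} _ sB sr (merge sA∪B equivalent ∣A∪B∣) =
    (A ∪ B) ∷ r , equivalent , sA∪B ∷ sr ,
    m<n+m (size r + lateness r) (<-≤-trans (x∈p⇒0<∣p∣ (proj₂ (proj₁ sB))) (m≤m+n ∣ B ∣ (size r))) ,
    (begin
      ∣ A ∪ B ∣ + size r         ≡⟨ cong (_+ size r) ∣A∪B∣ ⟩
      (∣ A ∣ + ∣ B ∣) + size r   ≡⟨ +-assoc (∣ A ∣) (∣ B ∣) (size r) ⟩
      ∣ A ∣ + (∣ B ∣ + size r)   ∎)
    where open ≡-Reasoning
  rewrite-improves {A} {B} {r} _ _ sr (advance C D sA∪C sD equivalent sizes _ D<B) =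
    (A ∪ C) ∷ D ∷ r , equivalent , sA∪C ∷ sD ∷ sr ,
    +-monoˡ-< (size r + lateness r) (+-monoˡ-< (size r) D<B) ,
    (begin
      ∣ A ∪ C ∣ + (∣ D ∣ + size r)   ≡⟨ +-assoc (∣ A ∪ C ∣) (∣ D ∣) (size r) ⟨
      (∣ A ∪ C ∣ + ∣ D ∣) + size r   ≡⟨ cong (_+ size r) sizes ⟩
      (∣ A ∣ + ∣ B ∣) + size r       ≡⟨ +-assoc (∣ A ∣) (∣ B ∣) (size r) ⟩
      ∣ A ∣ + (∣ B ∣ + size r)       ∎)
    where open ≡-Reasoning

  improvement-cons : ∀ {A x} → IsStep A → Improvement x → Improvement (A ∷ x)
  improvement-cons {A} {x} sA (x′ , x′≡x , sx′ , later , same-size) =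
    A ∷ x′ , ≡c-cons A x′≡x , sA ∷ sx′ ,
    subst (λ t → t + lateness x′ < size x + lateness x) (sym same-size) (+-monoʳ-< (size x) later) ,
    cong (∣ A ∣ +_) same-size

  canonical-or-improvable : ∀ x → StepSeq x → ¬ ¬ (Canonical x ⊎ Improvement x)
  canonical-or-improvable []          _                    k = k (inj₁ tt)
  canonical-or-improvable (A ∷ [])    _                    k = k (inj₁ tt)
  canonical-or-improvable (A ∷ B ∷ r) (sA ∷ sB ∷ sr) k =
    decide-head (canonical-or-improvable (B ∷ r) (sB ∷ sr))
    where
      decide-head : ¬ ¬ (Canonical (B ∷ r) ⊎ Improvement (B ∷ r)) → ⊥
      decide-head tail-case = ¬¬-excluded-middle λ where
        (yes fd) → k (inj₂ (rewrite-improves sA sB sr (fd-rewrite r sA sB fd)))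
        (no ¬fd) → tail-case λ where
          (inj₁ cBr) → k (inj₁ (¬fd , cBr))
          (inj₂ imp) → k (inj₂ (improvement-cons sA imp))

  CanonicalRepresentative : L → Set
  CanonicalRepresentative x = Σ[ w ∈ L ] (Canonical w × StepSeq w × w ≡c x)

  ¬¬-canonical-representative : ∀ x → StepSeq x → ¬ ¬ CanonicalRepresentative x
  ¬¬-canonical-representative x = <-rec Goal reduce (lateness x) x refl
    where
      Goal : ℕ → Set
      Goal m = ∀ y → lateness y ≡ m → StepSeq y → ¬ ¬ CanonicalRepresentative y
      reduce : ∀ m → (∀ {m′} → m′ < m → Goal m′) → Goal m
      reduce _ smaller y refl sy k = canonical-or-improvable y sy λ where
        (inj₁ cy) → k (y , cy , sy , ε)
        (inj₂ (y′ , y′≡y , sy′ , later , _)) →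
          smaller later y′ refl sy′ λ (w , cw , sw , w≡y′) → k (w , cw , sw , ≡c-trans w≡y′ y′≡y)

  maxconc-tail : ∀ {A u} → IsStep A → MaxConcurrent (A ∷ u) → MaxConcurrent u
  maxconc-tail {A} sA (shortest , mc-order) =
    (λ v sv v≡u → s≤s⁻¹ (shortest (A ∷ v) (sA ∷ sv) (≡c-cons A v≡u))) ,
    (λ i i<len → mc-order (suc i) (s≤s i<len))

  -- The last step of a sequence is maximally concurrent (a one-step sequence
  -- is canonical), so mc is defined on nonempty sequences.
  last-maximal : ∀ A r → StepSeq (A ∷ r) → MaxConcAt (A ∷ r) (length r)
  last-maximal A []      su       = canonical-head-maximal tt su
  last-maximal A (B ∷ r) (_ ∷ su) = last-maximal B r su

  canonical-mc : ∀ {w} → Canonical w → StepSeq w → 0 < length w → IsMc w 0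
  canonical-mc {_ ∷ _} cw sw _ = canonical-head-maximal cw sw , λ _ ()

  -- A maximally concurrent sequence has no forward dependency at its head:
  -- merging would shorten it, and advancing would make mc positive while
  -- its canonical representative (of the same length) has mc 0.
  maxconc-head-independent : ∀ {A B z} → StepSeq (A ∷ B ∷ z) → MaxConcurrent (A ∷ B ∷ z) → ¬ FD A B
  maxconc-head-independent {A} {B} {z} ss@(sA ∷ sB ∷ sz) (shortest , mc-order) fd
    with fd-rewrite z sA sB fd
  ... | merge sA∪B equivalent _ = 1+n≰n (shortest ((A ∪ B) ∷ z) (sA∪B ∷ sz) equivalent)
  ... | advance C D sA∪C sD equivalent _ A<A∪C _ =
    ¬¬-least (MaxConcAt s) (length (B ∷ z)) (last-maximal A (B ∷ z) ss) λ (a , mc-s) →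
    ¬¬-canonical-representative s ss λ rep →
    head-not-maximal (subst (MaxConcAt s) (mc-zero a mc-s rep) (proj₁ mc-s))
    where
      s : L
      s = A ∷ B ∷ z
      head-not-maximal : ¬ MaxConcHead s
      head-not-maximal maximal = <⇒≱ A<A∪C (maximal (A ∪ C) (D ∷ z) sA∪C (sD ∷ sz) equivalent)
      mc-zero : ∀ a → IsMc s a → CanonicalRepresentative s → a ≡ 0
      mc-zero a mc-s (w , cw , sw , w≡s) =
        n≤0⇒n≡0 (mc-order zero (s≤s z≤n) w sw (≡c-sym w≡s) same-length a 0 mc-s
                   (canonical-mc cw sw (subst (0 <_) same-length (s≤s z≤n))))
        where
          same-length : length s ≡ length w
          same-length = ≤-antisym (shortest w sw w≡s) (canonical-shortest cw sw (≡c-sym w≡s))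

  maxconc⇒canonical : ∀ {u} → StepSeq u → MaxConcurrent u → Canonical u
  maxconc⇒canonical {[]}        _               _  = tt
  maxconc⇒canonical {_ ∷ []}    _               _  = tt
  maxconc⇒canonical {_ ∷ _ ∷ _} su@(sA ∷ sBr) mc =
    maxconc-head-independent su mc , maxconc⇒canonical sBr (maxconc-tail sA mc)

theorem8p4 : ∀ {n : ℕ} (Σ : ComtraceAlphabet n) (u : List (Subset n)) →
  Comtrace.StepSeq Σ u →
  (Comtrace.MaxConcurrent Σ u ⇔ Comtrace.Canonical Σ u)
theorem8p4 Σ u su = mk⇔ (λ mc → maxconc⇒canonical su mc) (λ cu → canonical⇒maxconc cu su)
  where open ComtraceTheory Σ
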